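{- Let $\Sigma$ be a finite alphabet. For all $S \subset \Sigma^*$, all $A \subset S$ and all $s \in \Sigma^*$, we have $|c^*_S(s)| \le |c^*_A(s)|$, and consequently $\mathscr{S}(s,S) \ge \mathscr{S}(s,A)$.
   Context: Throughout, "subsequence" means a contiguous block of consecutive elements (a factor/substring); $\epsilon$ is the empty sequence and $|s|$ the length of $s$. For $T \subset \Sigma^*$, $T_{sub}$ is the set of all non-empty contiguous subsequences of elements of $T \cup \Sigma$ (letters viewed as length-1 sequences). A full covering of $s$ by $T$ is a multiset of elements of $T_{sub}$, each a contiguous subsequence of $s$ (repeated copies corresponding to distinct occurrences in $s$), that can be arranged to cover every position of $s$; a $T$-optimal covering $c^*_T(s)$ is a full covering with the minimum number $|c^*_T(s)|$ of elements (the empty sequence is covered by the empty covering). The covering similarity is, for non-empty $s$, $\mathscr{S}(s,T) = \frac{|s| - |c^*_T(s)| + 1}{|s|}$, and $\mathscr{S}(\epsilon,T) = 1$ for all $T$. -}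

module Defs where

open import Data.Nat using (ℕ; suc; _<_; _≤_; _∸_)
open import Data.Fin using (Fin)
open import Data.List using (List; []; _∷_; [_]; _++_; length; take; drop)
open import Data.List.Relation.Unary.All using (All)
open import Data.List.Relation.Unary.Any using (Any)
open import Data.List.Relation.Unary.Unique.Propositional using (Unique)
open import Data.Product using (Σ; ∃; ∃-syntax; _×_; _,_)
open import Data.Sum using (_⊎_)
open import Data.Integer using (ℤ; +_; _-_; _+_; 1ℤ)
open import Data.Rational using (ℚ; _/_; 1ℚ)
open import Relation.Binary.PropositionalEquality using (_≡_; _≢_)

-- A finite alphabet Σ is represented (up to renaming) by Fin k.
-- Sequences over Σ are lists; a set T ⊂ Σ* is a predicate on lists.
Word : ℕ → Set
Word k = List (Fin k)

Lang : ℕ → Set₁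
Lang k = Word k → Set

Factor : ∀ {k} → Word k → Word k → Set
Factor u t = ∃[ xs ] ∃[ ys ] (xs ++ u ++ ys ≡ t)

TSub : ∀ {k} → Lang k → Word k → Set
TSub {k} T u = (u ≢ []) × ((∃[ t ] (T t × Factor u t)) ⊎ (∃[ a ] (Factor u [ a ])))

-- the factor of s occupying positions i, i+1, ..., j-1
slice : ∀ {k} → Word k → ℕ → ℕ → Word k
slice s i j = take (j ∸ i) (drop i s)

ValidOcc : ∀ {k} → Lang k → Word k → ℕ × ℕ → Set
ValidOcc T s (i , j) = (i < j) × (j ≤ length s) × TSub T (slice s i j)

CoversPos : ℕ → ℕ × ℕ → Set
CoversPos p (i , j) = (i ≤ p) × (p < j)

FullCovering : ∀ {k} → Lang k → Word k → List (ℕ × ℕ) → Set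
FullCovering T s c =
  Unique c × All (ValidOcc T s) c
  × (∀ p → p < length s → Any (CoversPos p) c)

HasCoveringOfSize : ∀ {k} → Lang k → Word k → ℕ → Set
HasCoveringOfSize T s n = ∃[ c ] (FullCovering T s c × length c ≡ n)

OptimalSize : ∀ {k} → Lang k → Word k → ℕ → Set
OptimalSize T s n = HasCoveringOfSize T s n × (∀ m → HasCoveringOfSize T s m → n ≤ m)

similarity : ∀ {k} → Word k → ℕ → ℚ
similarity [] n = 1ℚ
similarity s@(_ ∷ _) n = ((+ length s) - (+ n) + 1ℤ) / length s

module Submission where

-- If A ⊆ S then A_sub ⊆ S_sub, so every occurrence that is valid for A is
-- valid for S, and every full covering of s by A is, verbatim, a full
-- covering of s by S.  Hence an A-optimal covering of size m is an
-- S-covering of size m, and S-optimality gives |c*_S(s)| = n ≤ m.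

open import Defs
open import Data.Nat using (ℕ; suc; _≤_; NonZero)
open import Data.Product using (_×_; _,_)
open import Data.Sum using (inj₁; inj₂)
open import Data.List using (_∷_; []; length)
import Data.List.Relation.Unary.All as All
open import Data.Integer using (ℤ; +_; +≤+; _-_; _+_; 1ℤ) renaming (_≤_ to _≤ℤ_)
import Data.Integer.Properties as ℤ
open import Data.Rational using (_/_) renaming (_≤_ to _≤ℚ_)
import Data.Rational.Properties as ℚ
open import Data.Rational.Unnormalised using (mkℚᵘ; *≤*)
import Data.Rational.Unnormalised.Properties as ℚᵘ

module _ {k : ℕ} {S A : Lang k} (A⊆S : ∀ {w} → A w → S w) where

  tsub-mono : ∀ {u} → TSub A u → TSub S u
  tsub-mono (u≢[] , inj₁ (t , At , u-in-t)) = u≢[] , inj₁ (t , A⊆S At , u-in-t)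
  tsub-mono (u≢[] , inj₂ u-is-letter)       = u≢[] , inj₂ u-is-letter

  validOcc-mono : ∀ {s} occ → ValidOcc A s occ → ValidOcc S s occ
  validOcc-mono _ (i<j , j≤|s| , inA) = i<j , j≤|s| , tsub-mono inA

  -- A full covering by A is the same list viewed as a full covering by S:
  -- distinctness and coverage do not mention the language at all.
  fullCovering-mono : ∀ {s c} → FullCovering A s c → FullCovering S s c
  fullCovering-mono (unique , valid , covers) =
    unique , All.map (validOcc-mono _) valid , covers

  hasCoveringOfSize-mono : ∀ {s m} → HasCoveringOfSize A s m → HasCoveringOfSize S s m
  hasCoveringOfSize-mono (c , full , |c|≡m) = c , fullCovering-mono full , |c|≡m

  -- |c*_S(s)| ≤ |c*_A(s)|: an A-optimal covering competes among S-coverings.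
  optimalSize-antitone : ∀ {s n m} → OptimalSize S s n → OptimalSize A s m → n ≤ m
  optimalSize-antitone (_ , S-minimal) (A-covering , _) =
    S-minimal _ (hasCoveringOfSize-mono A-covering)

-- Here a / suc d is
-- definitionally fromℚᵘ (mkℚᵘ a d), so the inequality is transported from
-- the unnormalised fractions, where it is a ≤ b scaled by suc d.
/-monoˡ-≤ : ∀ {a b : ℤ} d .{{_ : NonZero d}} → a ≤ℤ b → a / d ≤ℚ b / d
/-monoˡ-≤ {a} {b} (suc d) a≤b = ℚ.toℚᵘ-cancel-≤
  (ℚᵘ.≤-respʳ-≃ (ℚᵘ.≃-sym (ℚ.toℚᵘ-fromℚᵘ (mkℚᵘ b d)))
    (ℚᵘ.≤-respˡ-≃ (ℚᵘ.≃-sym (ℚ.toℚᵘ-fromℚᵘ (mkℚᵘ a d)))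
      (*≤* (ℤ.*-monoʳ-≤-nonNeg (+ suc d) a≤b))))

numerator-antitone : ∀ l {n m} → n ≤ m → + l - + m + 1ℤ ≤ℤ + l - + n + 1ℤ
numerator-antitone l n≤m =
  ℤ.+-monoˡ-≤ 1ℤ (ℤ.+-monoʳ-≤ (+ l) (ℤ.neg-mono-≤ (+≤+ n≤m)))

similarity-antitone : ∀ {k} (s : Word k) {n m} → n ≤ m → similarity s m ≤ℚ similarity s n
similarity-antitone []        n≤m = ℚ.≤-refl
similarity-antitone s@(_ ∷ _) n≤m =
  /-monoˡ-≤ (length s) (numerator-antitone (length s) n≤m)

proposition2 : ∀ {k} (S A : Lang k) → (∀ {w} → A w → S w) → (s : Word k) →
    ∀ n m → OptimalSize S s n → OptimalSize A s m →
    (n ≤ m) × (similarity s m ≤ℚ similarity s n)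
proposition2 S A A⊆S s n m optS optA = n≤m , similarity-antitone s n≤m
  where
  n≤m : n ≤ m
  n≤m = optimalSize-antitone A⊆S optS optA
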